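{- Let $\mathcal{K}'\subseteq\mathcal{K}\subseteq\mathsf{REL}$ and let $t,u$ be $\mathrm{PCoR}_{\{{}^*,\overline{\mathrm{I}},\overline{x}\}}$ terms. If $\mathcal{K}'$ is a witness-basis of $\mathcal{K}$ for $t$, then $\mathcal{K}'\models t\le u$ if and only if $\mathcal{K}\models t\le u$.
   Context: Variables form a countably infinite set. $\mathrm{PCoR}_{\{{}^*,\overline{\mathrm{I}},\overline{x}\}}$ terms are built from variables and constants $\mathrm{I}$ (identity), $0$, $\top$ (full relation), $\overline{\mathrm{I}}$ (complement of identity) using $;$, $+$, $\cap$, ${}^{\smile}$ (converse), ${}^*$ (reflexive transitive closure) and complement $\overline{x}$ applied only to variables. A valuation $v$ over a nonempty set $A$ maps variables to binary relations on $A$, extended relationally to $\hat v$; $\mathsf{REL}$ is the class of all valuations. $\mathcal{K}\models t\le u$ means $\hat v(t)\subseteq\hat v(u)$ for all $v\in\mathcal{K}$. For nonempty $B\subseteq A$, the submodel $v\restriction B$ is the valuation over $B$ mapping each variable $x$ to $v(x)\cap B^2$. $\mathcal{K}'$ is a witness-basis of $\mathcal{K}$ for $t$ if for every $v\in\mathcal{K}$ and every $(x,y)\in\hat v(t)$ there is a nonempty subset $B$ of the base set of $v$ with $v\restriction B\in\mathcal{K}'$ and $(x,y)\in\widehat{v\restriction B}(t)$. -}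

module Defs where

open import Data.Nat using (ℕ)
open import Data.Empty using (⊥)
open import Data.Unit using (⊤)
open import Data.Sum using (_⊎_)
open import Data.Product using (Σ; ∃; _×_; _,_; proj₁)
open import Relation.Nullary using (¬_)
open import Relation.Nullary.Irrelevant using (Irrelevant)
open import Relation.Binary.PropositionalEquality using (_≡_)
open import Relation.Binary.Construct.Closure.ReflexiveTransitive using (Star)

Var : Set
Var = ℕ

data Term : Set where
  var   : Var → Term
  cvar  : Var → Term
  I     : Term
  𝟘     : Term
  ⊤t    : Term
  nI    : Term
  _⨾_   : Term → Term → Term
  _⊕_   : Term → Term → Term
  _⊓_   : Term → Term → Term
  _˘    : Term → Term
  _⋆    : Term → Term

-- A valuation: a base set together with an interpretation of each variable
-- as a binary relation on it. (Nonemptiness is the predicate REL below.)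
record Valuation : Set₁ where
  field
    Carrier : Set
    val     : Var → Carrier → Carrier → Set
open Valuation public

⟦_⟧ : Term → (v : Valuation) → Carrier v → Carrier v → Set
⟦ var x  ⟧ v a b = val v x a b
⟦ cvar x ⟧ v a b = ¬ val v x a b
⟦ I      ⟧ v a b = a ≡ b
⟦ 𝟘      ⟧ v a b = ⊥
⟦ ⊤t     ⟧ v a b = ⊤
⟦ nI     ⟧ v a b = ¬ (a ≡ b)
⟦ t ⨾ u  ⟧ v a b = ∃ λ c → ⟦ t ⟧ v a c × ⟦ u ⟧ v c b
⟦ t ⊕ u  ⟧ v a b = ⟦ t ⟧ v a b ⊎ ⟦ u ⟧ v a b
⟦ t ⊓ u  ⟧ v a b = ⟦ t ⟧ v a b × ⟦ u ⟧ v a b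
⟦ t ˘    ⟧ v a b = ⟦ t ⟧ v b a
⟦ t ⋆    ⟧ v a b = Star (⟦ t ⟧ v) a b

Class : Set₂
Class = Valuation → Set₁

REL : Class
REL v = Lift′ (Carrier v)
  where
  open import Level using (Lift)
  Lift′ : Set → Set₁
  Lift′ A = Lift _ A

_⊆ᶜ_ : Class → Class → Set₁
K ⊆ᶜ K′ = ∀ v → K v → K′ v

_⊨_≤_ : Class → Term → Term → Set₁
K ⊨ t ≤ u = ∀ v → K v → ∀ a b → ⟦ t ⟧ v a b → ⟦ u ⟧ v a b

_↾_ : (v : Valuation) → (Carrier v → Set) → Valuation
Carrier (v ↾ B) = Σ (Carrier v) B
val (v ↾ B) x a b = val v x (proj₁ a) (proj₁ b)

-- K′ is a witness-basis of K for t.  Nonemptiness of B is witnessed by a ∈ B.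
WitnessBasis : Class → Class → Term → Set₁
WitnessBasis K′ K t =
  ∀ v → K v → ∀ a b → ⟦ t ⟧ v a b →
  Σ (Carrier v → Set) λ B →
    (∀ c → Irrelevant (B c)) ×
    Σ (B a) λ pa → Σ (B b) λ pb →
      K′ (v ↾ B) × ⟦ t ⟧ (v ↾ B) (a , pa) (b , pb)

-- The inclusion of a submodel v ↾ B into v is an injective map that keeps every
-- variable's relation (restricted to B), so every term — including x̄ and Ī,
-- which are not monotone — satisfied in v ↾ B is satisfied in v at the
-- underlying points. Hence if t ≤ u holds on K′ and (a, b) ∈ v̂(t) for some v in
-- K, a witness submodel in K′ gives (a, b) in its û, and so in v̂(u). The
-- converse is K′ ⊆ K.
module Submission where

open import Defs
open import Data.Product using (_×_; Σ; _,_; proj₁)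
open import Data.Sum using (inj₁; inj₂)
open import Function.Bundles using (_⇔_; mk⇔)
open import Relation.Nullary.Irrelevant using (Irrelevant)
open import Relation.Binary.PropositionalEquality using (_≡_; refl)
open import Relation.Binary.Construct.Closure.ReflexiveTransitive using (gmap)

module _ (v : Valuation) (B : Carrier v → Set) (B-irrelevant : ∀ c → Irrelevant (B c)) where

  proj₁-injective : (a b : Carrier (v ↾ B)) → proj₁ a ≡ proj₁ b → a ≡ b
  proj₁-injective (c , p) (.c , q) refl with B-irrelevant c p q
  ... | refl = refl

  ⟦⟧-↾⇒ : ∀ t (a b : Carrier (v ↾ B)) → ⟦ t ⟧ (v ↾ B) a b → ⟦ t ⟧ v (proj₁ a) (proj₁ b)
  ⟦⟧-↾⇒ (var x)  a b h                = h
  ⟦⟧-↾⇒ (cvar x) a b h                = h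
  ⟦⟧-↾⇒ I        a b refl             = refl
  ⟦⟧-↾⇒ 𝟘        a b ()
  ⟦⟧-↾⇒ ⊤t       a b h                = h
  ⟦⟧-↾⇒ nI       a b a≢b a₁≡b₁        = a≢b (proj₁-injective a b a₁≡b₁)
  ⟦⟧-↾⇒ (t ⨾ u)  a b (c , h₁ , h₂)    = proj₁ c , ⟦⟧-↾⇒ t a c h₁ , ⟦⟧-↾⇒ u c b h₂
  ⟦⟧-↾⇒ (t ⊕ u)  a b (inj₁ h)         = inj₁ (⟦⟧-↾⇒ t a b h)
  ⟦⟧-↾⇒ (t ⊕ u)  a b (inj₂ h)         = inj₂ (⟦⟧-↾⇒ u a b h)
  ⟦⟧-↾⇒ (t ⊓ u)  a b (h₁ , h₂)        = ⟦⟧-↾⇒ t a b h₁ , ⟦⟧-↾⇒ u a b h₂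
  ⟦⟧-↾⇒ (t ˘)    a b h                = ⟦⟧-↾⇒ t b a h
  ⟦⟧-↾⇒ (t ⋆)    a b h                = gmap proj₁ (⟦⟧-↾⇒ t _ _) h

witnessBasis⇒⊨-lift : ∀ {K′ K : Class} t u →
  WitnessBasis K′ K t → K′ ⊨ t ≤ u → K ⊨ t ≤ u
witnessBasis⇒⊨-lift t u basis t≤u v v∈K a b a∈t
  with basis v v∈K a b a∈t
... | B , B-irrelevant , a∈B , b∈B , v↾B∈K′ , a∈t↾B =
  ⟦⟧-↾⇒ v B B-irrelevant u (a , a∈B) (b , b∈B)
    (t≤u (v ↾ B) v↾B∈K′ (a , a∈B) (b , b∈B) a∈t↾B)

⊆ᶜ⇒⊨-restrict : ∀ {K′ K : Class} t u → K′ ⊆ᶜ K → K ⊨ t ≤ u → K′ ⊨ t ≤ u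
⊆ᶜ⇒⊨-restrict t u K′⊆K t≤u v v∈K′ = t≤u v (K′⊆K v v∈K′)

proposition15 : (K′ K : Class) → K′ ⊆ᶜ K → K ⊆ᶜ REL → (t u : Term) →
    WitnessBasis K′ K t → (K′ ⊨ t ≤ u) ⇔ (K ⊨ t ≤ u)
proposition15 K′ K K′⊆K _ t u basis =
  mk⇔ (witnessBasis⇒⊨-lift t u basis) (⊆ᶜ⇒⊨-restrict t u K′⊆K)
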